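{- Let $L < N \le 2L$ be positive integers, let $\boldsymbol\xi_1, \dots, \boldsymbol\xi_L \in F_N$, let $\Xi = (\boldsymbol\xi_1\ \cdots\ \boldsymbol\xi_L)$, and let $Y = \Xi^T = (\boldsymbol y_1\ \cdots\ \boldsymbol y_N) = (y_{\ell n})$ with columns $\boldsymbol y_n \in \mathbb{Z}^L$, all nonzero. For $\ell = 1,\dots,L$ let $S(\ell) = \{n : |y_{\ell n}| = 1\}$; for $A \subseteq \{1,\dots,N\}$ let $\eta(A) = \bigcup_{\ell:\, S(\ell)\cap A\ne\emptyset} S(\ell)$, and $\mathcal P = \{A : \eta(A) = A\}$. Let $A_1, \dots, A_r$ be the collection of all (distinct) nonempty minimal subsets in $\mathcal P$. Then $N - L \le r$. Moreover, if $\operatorname{rank} \Xi = \operatorname{rank} Y = L$, then $N - L = r$.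
   Context: $F_N = \{\boldsymbol e_m - \boldsymbol e_n : m\ne n\}$ with $\boldsymbol e_m$ the standard basis of $\mathbb{R}^N$. A nonempty set $A \in \mathcal P$ is minimal if for every nonempty subset $B \subseteq A$ with $B \ne A$ we have $\eta(B) \ne B$. -}

module Defs where

open import Data.Nat using (ℕ; zero; suc)
open import Data.Bool using (Bool; true; false; if_then_else_)
open import Data.Integer as ℤ using (ℤ; +_; ∣_∣)
open import Data.Rational as ℚ using (ℚ; 0ℚ)
open import Data.Fin using (Fin; zero; suc)
import Data.Fin
import Relation.Nullary
open import Data.Fin.Subset using (Subset; _∩_; _∪_; _⊆_; ⊥; Nonempty; ⋃)
open import Data.Fin.Subset.Properties using (nonempty?)
open import Data.Vec using (tabulate)
open import Data.List using (List)
open import Data.List.Base as List using (map)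
open import Data.List using (allFin)
open import Data.Product using (Σ; ∃; ∃-syntax; _×_; _,_)
open import Data.Nat using (_≡ᵇ_)
open import Relation.Nullary using (¬_; does)
open import Relation.Binary.PropositionalEquality using (_≡_; _≢_)
open import Function.Definitions using (Injective)

e : ∀ {N} → Fin N → Fin N → ℤ
e m k with Data.Fin._≟_ m k
... | Relation.Nullary.yes _ = + 1
... | Relation.Nullary.no _ = + 0

InF : ∀ {N} → (Fin N → ℤ) → Set
InF {N} v = ∃[ m ] ∃[ n ] (m ≢ n × (∀ k → v k ≡ e m k ℤ.- e n k))

-- Y = Ξ^T is the L × N matrix with rows ξ_ℓ ; y_{ℓ n} = ξ ℓ n.
-- S(ℓ) = { n : |y_{ℓ n}| = 1 }
S : ∀ {L N} → (Fin L → Fin N → ℤ) → Fin L → Subset N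
S ξ ℓ = tabulate (λ n → ∣ ξ ℓ n ∣ ≡ᵇ 1)

η : ∀ {L N} → (Fin L → Fin N → ℤ) → Subset N → Subset N
η {L} ξ A = ⋃ (map (λ ℓ → if does (nonempty? (S ξ ℓ ∩ A)) then S ξ ℓ else ⊥) (allFin L))

In𝒫 : ∀ {L N} → (Fin L → Fin N → ℤ) → Subset N → Set
In𝒫 ξ A = η ξ A ≡ A

Minimal : ∀ {L N} → (Fin L → Fin N → ℤ) → Subset N → Set
Minimal ξ A = Nonempty A × In𝒫 ξ A ×
  (∀ B → Nonempty B → B ⊆ A → B ≢ A → η ξ B ≢ B)

toℚ : ℤ → ℚ
toℚ z = z ℚ./ 1

sumℚ : ∀ {k} → (Fin k → ℚ) → ℚ
sumℚ {zero} f = 0ℚ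
sumℚ {suc k} f = f zero ℚ.+ sumℚ (λ i → f (suc i))

LinIndep : ∀ {k m} → (Fin k → Fin m → ℚ) → Set
LinIndep {k} {m} v =
  ∀ (c : Fin k → ℚ) → (∀ i → sumℚ (λ j → c j ℚ.* v j i) ≡ 0ℚ) → ∀ j → c j ≡ 0ℚ

cols : ∀ {m n k} → (Fin m → Fin n → ℤ) → (Fin k → Fin n) → Fin k → Fin m → ℚ
cols M σ j i = toℚ (M i (σ j))

HasRank : ∀ {m n} → (Fin m → Fin n → ℤ) → ℕ → Set
HasRank {m} {n} M r =
  (∃[ σ ] (Injective _≡_ _≡_ σ × LinIndep (cols {k = r} M σ))) ×
  (∀ (σ : Fin (suc r) → Fin n) → Injective _≡_ _≡_ σ → ¬ LinIndep (cols M σ))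

Ξmat : ∀ {L N} → (Fin L → Fin N → ℤ) → Fin N → Fin L → ℤ
Ξmat ξ n ℓ = ξ ℓ n

Ymat : ∀ {L N} → (Fin L → Fin N → ℤ) → Fin L → Fin N → ℤ
Ymat ξ ℓ n = ξ ℓ n

{-# OPTIONS --safe #-}
-- Each ξ_ℓ = e_m − e_n is an edge S(ℓ) = {m, n} of a graph on {1, …, N} without isolated
-- vertices. A set is η-closed iff it contains, with one endpoint of an edge, the other one, so the
-- minimal nonempty members of 𝒫 are exactly the connected components and r is their number.
-- Merging the endpoints of the edges one at a time (union–find) removes at most one class per
-- edge, whence r ≥ N − L. If the columns of Ξ are independent, no edge joins two vertices that are
-- already connected, as e_m − e_n would then be a combination of the other edges; so every edge
-- removes a class and r = N − L.
module Submission where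

open import Defs
open import Data.Bool using (Bool; true; false; if_then_else_)
import Data.Bool.Properties as Boolₚ
open import Data.Empty using (⊥-elim)
open import Data.Fin using (Fin; zero; suc; _≟_; punchOut)
open import Data.Fin.Properties using (any?; punchOut-injective; injective⇒≤; suc-injective)
open import Data.Fin.Subset as Subset using (Subset; ⋃; _∩_; _⊆_; Nonempty)
  renaming (_∈_ to _∈ₛ_)
open import Data.Fin.Subset.Properties
  using (x∈p∪q⁻; x∈p∪q⁺; ∉⊥; x∈p∩q⁺; x∈p∩q⁻; ⊆-antisym; nonempty?)
open import Data.Integer as ℤ using (ℤ; 0ℤ)
open import Data.List using (List; []; _∷_; length; map; filter; allFin; tabulate)
open import Data.List.Properties using (length-map; length-tabulate)
open import Data.List.Relation.Unary.Any using (here; there)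
open import Data.List.Relation.Unary.All as All using ()
open import Data.List.Relation.Unary.All.Properties using (All¬⇒¬Any)
open import Data.List.Relation.Unary.AllPairs using ([]; _∷_)
open import Data.List.Membership.Propositional using (_∈_; _∉_)
open import Data.List.Membership.Propositional.Properties
  using (∈-map⁻; ∈-map⁺; ∈-allFin; ∈-filter⁺; ∈-filter⁻)
open import Data.List.Membership.Propositional.Properties.WithK using (unique∧set⇒bag)
open import Data.List.Relation.Binary.BagAndSetEquality using (∼bag⇒↭)
open import Data.List.Relation.Binary.Permutation.Propositional.Properties using (↭-length)
open import Data.List.Relation.Unary.Unique.Propositional using (Unique)
import Data.List.Relation.Unary.Unique.Propositional.Properties as Uniqueₚ
open import Data.Nat using (ℕ; zero; suc; _+_; _≤_; _<_; _*_; _∸_; _≡ᵇ_)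
import Data.Nat.Properties as ℕₚ
open import Data.Product using (Σ; ∃; ∃-syntax; _×_; _,_; proj₁; proj₂)
open import Data.Rational as ℚ using (ℚ; 0ℚ; 1ℚ)
import Data.Rational.Properties as ℚₚ
open import Data.Rational.Solver using (module +-*-Solver)
open import Data.Sum using (_⊎_; inj₁; inj₂)
import Data.Vec as Vec
open import Data.Vec.Properties using (lookup∘tabulate; []=⇒lookup; lookup⇒[]=; ≡-dec)
open import Function using (_∘_; id)
open import Function.Bundles using (_⇔_; mk⇔)
open import Function.Properties.Equivalence using () renaming (trans to ⇔-trans)
open import Function.Definitions using (Injective)
open import Relation.Nullary using (¬_; Dec; yes; no; does)
open import Relation.Nullary.Decidable using (dec-true; dec-false)
open import Relation.Unary using (Decidable)
open import Relation.Binary.PropositionalEquality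

does⇒ : ∀ {A : Set} (a? : Dec A) → does a? ≡ true → A
does⇒ (yes a) _ = a
does⇒ (no _) ()

count : ∀ {n} → (Fin n → Bool) → ℕ
count {zero}  f = 0
count {suc n} f = (if f zero then 1 else 0) + count (f ∘ suc)

count-cong : ∀ {n} {f g : Fin n → Bool} → (∀ x → f x ≡ g x) → count f ≡ count g
count-cong {zero}  f≗g = refl
count-cong {suc n} f≗g =
  cong₂ _+_ (cong (λ b → if b then 1 else 0) (f≗g zero)) (count-cong (f≗g ∘ suc))

count-true : ∀ {n} {f : Fin n → Bool} → (∀ x → f x ≡ true) → count f ≡ n
count-true {zero}      _ = refl
count-true {suc n} {f} f≡true rewrite f≡true zero = cong suc (count-true (f≡true ∘ suc))

count-drop : ∀ {n} {f g : Fin n → Bool} b → f b ≡ true → g b ≡ false →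
             (∀ x → x ≢ b → f x ≡ g x) → count f ≡ suc (count g)
count-drop zero fb gb f≗g rewrite fb | gb = cong suc (count-cong (λ x → f≗g (suc x) λ ()))
count-drop {g = g} (suc b) fb gb f≗g rewrite f≗g zero (λ ()) =
  trans (cong ((if g zero then 1 else 0) +_)
              (count-drop b fb gb (λ x x≢b → f≗g (suc x) (x≢b ∘ suc-injective))))
        (ℕₚ.+-suc _ _)

length-filter-tabulate : ∀ {A : Set} {P : A → Set} (P? : Decidable P) {n} (f : Fin n → A) →
                         length (filter P? (tabulate f)) ≡ count (λ i → does (P? (f i)))
length-filter-tabulate P? {zero}  f = refl
length-filter-tabulate P? {suc n} f with does (P? (f zero))
... | true  = cong suc (length-filter-tabulate P? (f ∘ suc))
... | false = length-filter-tabulate P? (f ∘ suc)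

unique-map-injectiveOn : ∀ {A B : Set} (f : A → B) {xs : List A} → Unique xs →
                         (∀ {x y} → x ∈ xs → y ∈ xs → f x ≡ f y → x ≡ y) → Unique (map f xs)
unique-map-injectiveOn f {[]}     []           inj = []
unique-map-injectiveOn f {x ∷ xs} (x∉xs ∷ xs!) inj =
  All.tabulate fx∉ ∷ unique-map-injectiveOn f xs! (λ x∈ y∈ → inj (there x∈) (there y∈))
  where
  fx∉ : ∀ {z} → z ∈ map f xs → f x ≢ z
  fx∉ z∈ fx≡z with ∈-map⁻ f z∈
  ... | y , y∈ , refl = All.lookup x∉xs y∈ (inj (here refl) (there y∈) fx≡z)

length-unique-⇔ : ∀ {A : Set} {xs ys : List A} → Unique xs → Unique ys →
                  (∀ {x} → x ∈ xs ⇔ x ∈ ys) → length xs ≡ length ys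
length-unique-⇔ xs! ys! xs⇔ys = ↭-length (∼bag⇒↭ (unique∧set⇒bag xs! ys! xs⇔ys))

injective⇒surjective : ∀ {n} {σ : Fin n → Fin n} → Injective _≡_ _≡_ σ → ∀ t → ∃ λ j → σ j ≡ t
injective⇒surjective {suc n} {σ} σ-inj t with any? (λ j → σ j ≟ t)
... | yes hit  = hit
... | no  miss = ⊥-elim (ℕₚ.n≮n n (injective⇒≤ {f = avoid} avoid-inj))
  where
  t≢σ : ∀ j → t ≢ σ j
  t≢σ j t≡σj = miss (j , sym t≡σj)
  avoid : Fin (suc n) → Fin n
  avoid j = punchOut (t≢σ j)
  avoid-inj : Injective _≡_ _≡_ avoid
  avoid-inj {j} {k} = σ-inj ∘ punchOut-injective (t≢σ j) (t≢σ k)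

δ : ∀ {k} → Fin k → Fin k → ℚ
δ a b = if does (a ≟ b) then 1ℚ else 0ℚ

δ-diag : ∀ {k} (a : Fin k) → δ a a ≡ 1ℚ
δ-diag a = cong (λ t → if t then 1ℚ else 0ℚ) (dec-true (a ≟ a) refl)

δ-offDiag : ∀ {k} {a b : Fin k} → a ≢ b → δ a b ≡ 0ℚ
δ-offDiag {a = a} {b} a≢b = cong (λ t → if t then 1ℚ else 0ℚ) (dec-false (a ≟ b) a≢b)

sumℚ-zero : ∀ {k} (v : Fin k → ℚ) → sumℚ (λ j → 0ℚ ℚ.* v j) ≡ 0ℚ
sumℚ-zero {zero}  v = refl
sumℚ-zero {suc k} v = cong₂ ℚ._+_ (ℚₚ.*-zeroˡ (v zero)) (sumℚ-zero (v ∘ suc))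

sumℚ-sub : ∀ {k} (c c′ v : Fin k → ℚ) →
           sumℚ (λ j → (c j ℚ.- c′ j) ℚ.* v j) ≡ sumℚ (λ j → c j ℚ.* v j) ℚ.- sumℚ (λ j → c′ j ℚ.* v j)
sumℚ-sub {zero}  c c′ v = refl
sumℚ-sub {suc k} c c′ v =
  trans (cong ((c zero ℚ.- c′ zero) ℚ.* v zero ℚ.+_) (sumℚ-sub (c ∘ suc) (c′ ∘ suc) (v ∘ suc)))
        (solve 5 (λ a b x s t → (a :- b) :* x :+ (s :- t) := (a :* x :+ s) :- (b :* x :+ t)) refl
               (c zero) (c′ zero) (v zero) (sumℚ (λ j → c (suc j) ℚ.* v (suc j)))
               (sumℚ (λ j → c′ (suc j) ℚ.* v (suc j))))
  where open +-*-Solver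

sumℚ-δ : ∀ {k} (a : Fin k) (v : Fin k → ℚ) → sumℚ (λ j → δ a j ℚ.* v j) ≡ v a
sumℚ-δ zero    v = trans (cong₂ ℚ._+_ (ℚₚ.*-identityˡ (v zero)) (sumℚ-zero (v ∘ suc))) (ℚₚ.+-identityʳ _)
sumℚ-δ (suc a) v = trans (cong₂ ℚ._+_ (ℚₚ.*-zeroˡ (v zero)) (sumℚ-δ a (v ∘ suc))) (ℚₚ.+-identityˡ _)

EdgeClosed : ∀ {E N} → (Fin E → Fin N) → (Fin E → Fin N) → (Fin N → Set) → Set
EdgeClosed p q P = ∀ j → (P (p j) → P (q j)) × (P (q j) → P (p j))

module UnionFind {N E : ℕ} (p q : Fin E → Fin N) where

  redirect : Fin N → Fin N → Fin N → Fin N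
  redirect a b y with y ≟ b
  ... | yes _ = a
  ... | no  _ = y

  RedirectCase : Fin N → Fin N → Fin N → Set
  RedirectCase a b y = (y ≡ b × redirect a b y ≡ a) ⊎ (y ≢ b × redirect a b y ≡ y)

  redirect-cases : ∀ a b y → RedirectCase a b y
  redirect-cases a b y with y ≟ b
  ... | yes y≡b = inj₁ (y≡b , refl)
  ... | no  y≢b = inj₂ (y≢b , refl)

  redirect-target : ∀ a b → redirect a b a ≡ a
  redirect-target a b with redirect-cases a b a
  ... | inj₁ (_ , r≡a) = r≡a
  ... | inj₂ (_ , r≡a) = r≡a

  redirect-source : ∀ a b → redirect a b b ≡ a
  redirect-source a b with redirect-cases a b b
  ... | inj₁ (_ , r≡a)   = r≡a
  ... | inj₂ (b≢b , _) = ⊥-elim (b≢b refl)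

  label : List (Fin E) → Fin N → Fin N
  label []       x = x
  label (j ∷ js) x = redirect (label js (p j)) (label js (q j)) (label js x)

  label-idempotent : ∀ js x → label js (label js x) ≡ label js x
  label-idempotent []       x = refl
  label-idempotent (j ∷ js) x with redirect-cases (label js (p j)) (label js (q j)) (label js x)
  ... | inj₁ (_ , r≡a) = begin
    redirect a b (label js (label (j ∷ js) x)) ≡⟨ cong (redirect a b ∘ label js) r≡a ⟩
    redirect a b (label js a)                  ≡⟨ cong (redirect a b) (label-idempotent js (p j)) ⟩
    redirect a b a                             ≡⟨ redirect-target a b ⟩
    a                                          ≡⟨ r≡a ⟨
    label (j ∷ js) x                           ∎
    where open ≡-Reasoning; a = label js (p j); b = label js (q j)
  ... | inj₂ (_ , r≡y) = begin
    redirect a b (label js (label (j ∷ js) x)) ≡⟨ cong (redirect a b ∘ label js) r≡y ⟩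
    redirect a b (label js (label js x))       ≡⟨ cong (redirect a b) (label-idempotent js x) ⟩
    label (j ∷ js) x                           ∎
    where open ≡-Reasoning; a = label js (p j); b = label js (q j)

  label-merges : ∀ {j} js → j ∈ js → label js (p j) ≡ label js (q j)
  label-merges (j ∷ js) (here refl) =
    trans (redirect-target (label js (p j)) _) (sym (redirect-source _ (label js (q j))))
  label-merges (j ∷ js) (there j∈js) = cong (redirect _ _) (label-merges js j∈js)

  label-respects-closed : ∀ {P} → EdgeClosed p q P → ∀ js {x y} → P x → label js y ≡ label js x → P y
  label-respects-closed {P} closed [] Px y≡x = subst P (sym y≡x) Px
  label-respects-closed {P} closed (j ∷ js) {x} {y} Px ly≡lx =
    by-cases (redirect-cases a b (label js y)) (redirect-cases a b (label js x))
    where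
    a = label js (p j)
    b = label js (q j)
    recurse : ∀ {x y} → P x → label js y ≡ label js x → P y
    recurse = label-respects-closed closed js
    by-cases : RedirectCase a b (label js y) → RedirectCase a b (label js x) → P y
    by-cases (inj₁ (y≡b , _))    (inj₁ (x≡b , _))    = recurse Px (trans y≡b (sym x≡b))
    by-cases (inj₂ (_ , ry≡y))   (inj₂ (_ , rx≡x))   = recurse Px (trans (sym ry≡y) (trans ly≡lx rx≡x))
    by-cases (inj₁ (y≡b , ry≡a)) (inj₂ (_ , rx≡x))   =
      recurse (proj₁ (closed j) (recurse Px (trans (sym ry≡a) (trans ly≡lx rx≡x)))) y≡b
    by-cases (inj₂ (_ , ry≡y))   (inj₁ (x≡b , rx≡a)) =
      recurse (proj₂ (closed j) (recurse Px (sym x≡b))) (trans (sym ry≡y) (trans ly≡lx rx≡a))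

  label-unchanged : ∀ j js → label js (p j) ≡ label js (q j) → ∀ x → label (j ∷ js) x ≡ label js x
  label-unchanged j js a≡b x with redirect-cases (label js (p j)) (label js (q j)) (label js x)
  ... | inj₁ (x≡b , r≡a) = trans r≡a (trans a≡b (sym x≡b))
  ... | inj₂ (_ , r≡x)   = r≡x

  #roots : List (Fin E) → ℕ
  #roots js = count (λ x → does (label js x ≟ x))

  #roots-[] : #roots [] ≡ N
  #roots-[] = count-true (λ x → dec-true (x ≟ x) refl)

  #roots-unchanged : ∀ j js → label js (p j) ≡ label js (q j) → #roots (j ∷ js) ≡ #roots js
  #roots-unchanged j js a≡b =
    count-cong (λ x → cong (λ r → does (r ≟ x)) (label-unchanged j js a≡b x))

  -- The root of q j is the only root that stops being one.
  #roots-merge : ∀ j js → label js (p j) ≢ label js (q j) → #roots js ≡ suc (#roots (j ∷ js))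
  #roots-merge j js a≢b = count-drop b b-root b-not-root same-elsewhere
    where
    a = label js (p j)
    b = label js (q j)
    b-root : does (label js b ≟ b) ≡ true
    b-root = dec-true (label js b ≟ b) (label-idempotent js (q j))
    b-not-root : does (label (j ∷ js) b ≟ b) ≡ false
    b-not-root = dec-false (label (j ∷ js) b ≟ b) λ r≡b →
      a≢b (trans (sym (trans (cong (redirect a b) (label-idempotent js (q j))) (redirect-source a b))) r≡b)
    same-elsewhere : ∀ x → x ≢ b → does (label js x ≟ x) ≡ does (label (j ∷ js) x ≟ x)
    same-elsewhere x x≢b with redirect-cases a b (label js x)
    ... | inj₂ (_ , r≡x)   = cong (λ r → does (r ≟ x)) (sym r≡x)
    ... | inj₁ (x≡b , r≡a) =
      trans (dec-false (label js x ≟ x) (λ lx≡x → x≢b (trans (sym lx≡x) x≡b)))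
            (sym (dec-false (label (j ∷ js) x ≟ x) λ r≡x →
              a≢b (trans (sym (label-idempotent js (p j)))
                         (trans (cong (label js) (trans (sym r≡a) r≡x)) x≡b))))

  N≤length+#roots : ∀ js → N ≤ length js + #roots js
  N≤length+#roots []       = ℕₚ.≤-reflexive (sym #roots-[])
  N≤length+#roots (j ∷ js) with label js (p j) ≟ label js (q j)
  ... | yes a≡b = begin
    N                                 ≤⟨ N≤length+#roots js ⟩
    length js + #roots js             ≤⟨ ℕₚ.n≤1+n _ ⟩
    suc (length js + #roots js)       ≡⟨ cong (λ r → suc (length js + r)) (#roots-unchanged j js a≡b) ⟨
    suc (length js + #roots (j ∷ js)) ∎
    where open ℕₚ.≤-Reasoning
  ... | no  a≢b = begin
    N                                 ≤⟨ N≤length+#roots js ⟩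
    length js + #roots js             ≡⟨ cong (length js +_) (#roots-merge j js a≢b) ⟩
    length js + suc (#roots (j ∷ js)) ≡⟨ ℕₚ.+-suc (length js) _ ⟩
    suc (length js + #roots (j ∷ js)) ∎
    where open ℕₚ.≤-Reasoning

  Acyclic : Set
  Acyclic = ∀ j js → j ∉ js → label js (p j) ≢ label js (q j)

  length+#roots≡N : Acyclic → ∀ js → Unique js → length js + #roots js ≡ N
  length+#roots≡N acyclic []       []           = #roots-[]
  length+#roots≡N acyclic (j ∷ js) (j∉js ∷ js!) = begin
    suc (length js + #roots (j ∷ js)) ≡⟨ ℕₚ.+-suc (length js) _ ⟨
    length js + suc (#roots (j ∷ js)) ≡⟨ cong (length js +_) (#roots-merge j js merges) ⟨
    length js + #roots js             ≡⟨ length+#roots≡N acyclic js js! ⟩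
    N                                 ∎
    where
    open ≡-Reasoning
    merges : label js (p j) ≢ label js (q j)
    merges = acyclic j js (All¬⇒¬Any j∉js)

  N≤E+#roots : N ≤ E + #roots (allFin E)
  N≤E+#roots = subst (λ k → N ≤ k + #roots (allFin E)) (length-tabulate {n = E} id) (N≤length+#roots (allFin E))

  acyclic⇒E+#roots≡N : Acyclic → E + #roots (allFin E) ≡ N
  acyclic⇒E+#roots≡N acyclic = subst (λ k → k + #roots (allFin E) ≡ N) (length-tabulate {n = E} id)
                                     (length+#roots≡N acyclic (allFin E) (Uniqueₚ.allFin⁺ E))

  module Span {M : ℕ} (d : Fin N → Fin M → ℚ) (w : Fin E → Fin M → ℚ)
              (w≡ : ∀ j i → w j i ≡ d (p j) i ℚ.- d (q j) i) where

    InSpan : List (Fin E) → Fin N → Fin N → Set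
    InSpan js x y = Σ (Fin E → ℚ) λ c → (∀ j → j ∉ js → c j ≡ 0ℚ) ×
                    (∀ i → sumℚ (λ j → c j ℚ.* w j i) ≡ d x i ℚ.- d y i)

    span-refl : ∀ {js} x → InSpan js x x
    span-refl x = (λ _ → 0ℚ) , (λ _ _ → refl) ,
                  λ i → trans (sumℚ-zero (λ j → w j i)) (sym (ℚₚ.+-inverseʳ (d x i)))

    span-euclidean : ∀ {js x y z} → InSpan js x y → InSpan js x z → InSpan js y z
    span-euclidean {x = x} {y} {z} (c , c-supp , c-sum) (c′ , c′-supp , c′-sum) =
      (λ j → c′ j ℚ.- c j) , (λ j j∉ → cong₂ ℚ._-_ (c′-supp j j∉) (c-supp j j∉)) ,
      λ i → trans (sumℚ-sub c′ c (λ j → w j i))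
           (trans (cong₂ ℚ._-_ (c′-sum i) (c-sum i))
                  (solve 3 (λ a b e → (a :- e) :- (a :- b) := b :- e) refl (d x i) (d y i) (d z i)))
      where open +-*-Solver

    span-sym : ∀ {js x y} → InSpan js x y → InSpan js y x
    span-sym {x = x} x~y = span-euclidean x~y (span-refl x)

    span-trans : ∀ {js x y z} → InSpan js x y → InSpan js y z → InSpan js x z
    span-trans x~y y~z = span-euclidean (span-sym x~y) y~z

    span-weaken : ∀ {j js x y} → InSpan js x y → InSpan (j ∷ js) x y
    span-weaken (c , c-supp , c-sum) = c , (λ j′ j′∉ → c-supp j′ (j′∉ ∘ there)) , c-sum

    span-edge : ∀ j js → InSpan (j ∷ js) (p j) (q j)
    span-edge j js = δ j , (λ j′ j′∉ → δ-offDiag (λ j≡j′ → j′∉ (here (sym j≡j′)))) ,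
                     λ i → trans (sumℚ-δ j (λ j′ → w j′ i)) (w≡ j i)

    span-label : ∀ js x → InSpan js x (label js x)
    span-label []       x = span-refl x
    span-label (j ∷ js) x with redirect-cases (label js (p j)) (label js (q j)) (label js x)
    ... | inj₂ (_ , r≡x)   = subst (InSpan (j ∷ js) x) (sym r≡x) (span-weaken (span-label js x))
    ... | inj₁ (x≡b , r≡a) = subst (InSpan (j ∷ js) x) (sym r≡a)
      (span-trans (span-weaken (subst (InSpan js x) x≡b (span-label js x)))
      (span-trans (span-weaken (span-sym (span-label js (q j))))
      (span-trans (span-sym (span-edge j js))
                  (span-weaken (span-label js (p j))))))

    independent⇒edge∉span : LinIndep w → ∀ {j js} → j ∉ js → ¬ InSpan js (p j) (q j)
    independent⇒edge∉span indep {j} j∉js (c , c-supp , c-sum) = 0-1≢0 (begin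
      0ℚ ℚ.- 1ℚ         ≡⟨ cong₂ ℚ._-_ (c-supp j j∉js) (δ-diag j) ⟨
      c j ℚ.- δ j j     ≡⟨ indep (λ j′ → c j′ ℚ.- δ j j′) relation j ⟩
      0ℚ                ∎)
      where
      open ≡-Reasoning
      0-1≢0 : 0ℚ ℚ.- 1ℚ ≢ 0ℚ
      0-1≢0 ()
      relation : ∀ i → sumℚ (λ j′ → (c j′ ℚ.- δ j j′) ℚ.* w j′ i) ≡ 0ℚ
      relation i = begin
        sumℚ (λ j′ → (c j′ ℚ.- δ j j′) ℚ.* w j′ i)
          ≡⟨ sumℚ-sub c (δ j) (λ j′ → w j′ i) ⟩
        sumℚ (λ j′ → c j′ ℚ.* w j′ i) ℚ.- sumℚ (λ j′ → δ j j′ ℚ.* w j′ i)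
          ≡⟨ cong₂ ℚ._-_ (c-sum i) (trans (sumℚ-δ j (λ j′ → w j′ i)) (w≡ j i)) ⟩
        (d (p j) i ℚ.- d (q j) i) ℚ.- (d (p j) i ℚ.- d (q j) i)
          ≡⟨ ℚₚ.+-inverseʳ (d (p j) i ℚ.- d (q j) i) ⟩
        0ℚ ∎

    independent⇒acyclic : LinIndep w → Acyclic
    independent⇒acyclic indep j js j∉js a≡b = independent⇒edge∉span indep j∉js
      (span-trans (span-label js (p j))
                  (subst (λ r → InSpan js r (q j)) (sym a≡b) (span-sym (span-label js (q j)))))

∈-tabulate⁺ : ∀ {n} {f : Fin n → Bool} {x} → f x ≡ true → x ∈ₛ Vec.tabulate f
∈-tabulate⁺ {f = f} {x} fx = lookup⇒[]= x (Vec.tabulate f) (trans (lookup∘tabulate f x) fx)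

∈-tabulate⁻ : ∀ {n} {f : Fin n → Bool} {x} → x ∈ₛ Vec.tabulate f → f x ≡ true
∈-tabulate⁻ {f = f} {x} x∈ = trans (sym (lookup∘tabulate f x)) ([]=⇒lookup x∈)

∈-⋃⁻ : ∀ {n} (As : List (Subset n)) {x} → x ∈ₛ ⋃ As → ∃ λ A → A ∈ As × x ∈ₛ A
∈-⋃⁻ []       x∈ = ⊥-elim (∉⊥ x∈)
∈-⋃⁻ (A ∷ As) x∈ with x∈p∪q⁻ A (⋃ As) x∈
... | inj₁ x∈A = A , here refl , x∈A
... | inj₂ x∈⋃ with ∈-⋃⁻ As x∈⋃
... | B , B∈ , x∈B = B , there B∈ , x∈B

∈-⋃⁺ : ∀ {n} {As : List (Subset n)} {A x} → A ∈ As → x ∈ₛ A → x ∈ₛ ⋃ As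
∈-⋃⁺ {As = A ∷ As} (here refl) x∈A = x∈p∪q⁺ {p = A} {q = ⋃ As} (inj₁ x∈A)
∈-⋃⁺ {As = B ∷ As} (there A∈)  x∈A = x∈p∪q⁺ {p = B} {q = ⋃ As} (inj₂ (∈-⋃⁺ A∈ x∈A))

module _ {L N : ℕ} (ξ : Fin L → Fin N → ℤ) where

  private
    S-ifMeets : Subset N → Fin L → Subset N
    S-ifMeets A ℓ = if does (nonempty? (S ξ ℓ ∩ A)) then S ξ ℓ else Subset.⊥

    ∈-S-ifMeets⁻ : ∀ A ℓ {x} → x ∈ₛ S-ifMeets A ℓ → Nonempty (S ξ ℓ ∩ A) × x ∈ₛ S ξ ℓ
    ∈-S-ifMeets⁻ A ℓ x∈ with nonempty? (S ξ ℓ ∩ A)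
    ... | yes meets = meets , x∈
    ... | no  _     = ⊥-elim (∉⊥ x∈)

    ∈-S-ifMeets⁺ : ∀ A ℓ {x} → Nonempty (S ξ ℓ ∩ A) → x ∈ₛ S ξ ℓ → x ∈ₛ S-ifMeets A ℓ
    ∈-S-ifMeets⁺ A ℓ meets x∈ with nonempty? (S ξ ℓ ∩ A)
    ... | yes _      = x∈
    ... | no  ¬meets = ⊥-elim (¬meets meets)

  ∈-η⁻ : ∀ A {x} → x ∈ₛ η ξ A → ∃ λ ℓ → Nonempty (S ξ ℓ ∩ A) × x ∈ₛ S ξ ℓ
  ∈-η⁻ A x∈ with ∈-⋃⁻ (map (S-ifMeets A) (allFin L)) x∈
  ... | B , B∈ , x∈B with ∈-map⁻ (S-ifMeets A) B∈
  ... | ℓ , _ , refl = ℓ , ∈-S-ifMeets⁻ A ℓ x∈B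

  ∈-η⁺ : ∀ A ℓ {x} → Nonempty (S ξ ℓ ∩ A) → x ∈ₛ S ξ ℓ → x ∈ₛ η ξ A
  ∈-η⁺ A ℓ meets x∈ = ∈-⋃⁺ (∈-map⁺ (S-ifMeets A) (∈-allFin ℓ)) (∈-S-ifMeets⁺ A ℓ meets x∈)

e-diag : ∀ {N} (a : Fin N) → e a a ≡ ℤ.+ 1
e-diag a with a ≟ a
... | yes _   = refl
... | no  a≢a = ⊥-elim (a≢a refl)

e-offDiag : ∀ {N} {a k : Fin N} → a ≢ k → e a k ≡ ℤ.+ 0
e-offDiag {a = a} {k} a≢k with a ≟ k
... | yes a≡k = ⊥-elim (a≢k a≡k)
... | no  _   = refl

toℚ-e-sub : ∀ {N} (a b k : Fin N) → toℚ (e a k ℤ.- e b k) ≡ toℚ (e a k) ℚ.- toℚ (e b k)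
toℚ-e-sub a b k with a ≟ k | b ≟ k
... | yes _ | yes _ = refl
... | yes _ | no  _ = refl
... | no  _ | yes _ = refl
... | no  _ | no  _ = refl

module Edges {L N : ℕ} {ξ : Fin L → Fin N → ℤ} (ξ∈F : ∀ ℓ → InF (ξ ℓ))
             (covered : ∀ x → ∃[ ℓ ] (Ymat ξ ℓ x ≢ 0ℤ)) where

  src dst : Fin L → Fin N
  src ℓ = proj₁ (ξ∈F ℓ)
  dst ℓ = proj₁ (proj₂ (ξ∈F ℓ))

  src≢dst : ∀ ℓ → src ℓ ≢ dst ℓ
  src≢dst ℓ = proj₁ (proj₂ (proj₂ (ξ∈F ℓ)))

  ξ≡e-e : ∀ ℓ k → ξ ℓ k ≡ e (src ℓ) k ℤ.- e (dst ℓ) k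
  ξ≡e-e ℓ = proj₂ (proj₂ (proj₂ (ξ∈F ℓ)))

  Endpoint : Fin L → Fin N → Set
  Endpoint ℓ x = x ≡ src ℓ ⊎ x ≡ dst ℓ

  endpoint-or-zero : ∀ ℓ x → Endpoint ℓ x ⊎ ξ ℓ x ≡ 0ℤ
  endpoint-or-zero ℓ x with x ≟ src ℓ | x ≟ dst ℓ
  ... | yes x≡s | _       = inj₁ (inj₁ x≡s)
  ... | no  _   | yes x≡d = inj₁ (inj₂ x≡d)
  ... | no  x≢s | no  x≢d =
    inj₂ (trans (ξ≡e-e ℓ x) (cong₂ ℤ._-_ (e-offDiag (x≢s ∘ sym)) (e-offDiag (x≢d ∘ sym))))

  endpoint⇒∈S : ∀ {ℓ x} → Endpoint ℓ x → x ∈ₛ S ξ ℓ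
  endpoint⇒∈S {ℓ} (inj₁ refl) = ∈-tabulate⁺ (cong (λ v → ℤ.∣ v ∣ ≡ᵇ 1)
    (trans (ξ≡e-e ℓ (src ℓ)) (cong₂ ℤ._-_ (e-diag (src ℓ)) (e-offDiag (src≢dst ℓ ∘ sym)))))
  endpoint⇒∈S {ℓ} (inj₂ refl) = ∈-tabulate⁺ (cong (λ v → ℤ.∣ v ∣ ≡ᵇ 1)
    (trans (ξ≡e-e ℓ (dst ℓ)) (cong₂ ℤ._-_ (e-offDiag (src≢dst ℓ)) (e-diag (dst ℓ)))))

  ∈S⇒endpoint : ∀ {ℓ x} → x ∈ₛ S ξ ℓ → Endpoint ℓ x
  ∈S⇒endpoint {ℓ} {x} x∈ with endpoint-or-zero ℓ x
  ... | inj₁ endpoint = endpoint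
  ... | inj₂ ξℓx≡0 with trans (cong (λ v → ℤ.∣ v ∣ ≡ᵇ 1) (sym ξℓx≡0)) (∈-tabulate⁻ x∈)
  ... | ()

  Closed : Subset N → Set
  Closed A = EdgeClosed src dst (_∈ₛ A)

  In𝒫⇒closed : ∀ {A} → In𝒫 ξ A → Closed A
  In𝒫⇒closed {A} ηA≡A ℓ = across (inj₁ refl) (inj₂ refl) , across (inj₂ refl) (inj₁ refl)
    where
    across : ∀ {x y} → Endpoint ℓ x → Endpoint ℓ y → x ∈ₛ A → y ∈ₛ A
    across x-end y-end x∈A =
      subst (_ ∈ₛ_) ηA≡A (∈-η⁺ ξ A ℓ (_ , x∈p∩q⁺ (endpoint⇒∈S x-end , x∈A)) (endpoint⇒∈S y-end))

  closed-endpoints : ∀ {A} → Closed A → ∀ {ℓ x y} → Endpoint ℓ x → Endpoint ℓ y → x ∈ₛ A → y ∈ₛ A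
  closed-endpoints closed {ℓ} (inj₁ refl) (inj₁ refl) = id
  closed-endpoints closed {ℓ} (inj₁ refl) (inj₂ refl) = proj₁ (closed ℓ)
  closed-endpoints closed {ℓ} (inj₂ refl) (inj₁ refl) = proj₂ (closed ℓ)
  closed-endpoints closed {ℓ} (inj₂ refl) (inj₂ refl) = id

  closed⇒In𝒫 : ∀ {A} → Closed A → In𝒫 ξ A
  closed⇒In𝒫 {A} closed = ⊆-antisym ηA⊆A A⊆ηA
    where
    ηA⊆A : η ξ A ⊆ A
    ηA⊆A x∈ with ∈-η⁻ ξ A x∈
    ... | ℓ , (y , y∈S∩A) , x∈S with x∈p∩q⁻ (S ξ ℓ) A y∈S∩A
    ... | y∈S , y∈A = closed-endpoints closed (∈S⇒endpoint y∈S) (∈S⇒endpoint x∈S) y∈A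
    A⊆ηA : A ⊆ η ξ A
    A⊆ηA {x} x∈A with covered x
    ... | ℓ , ξℓx≢0 with endpoint-or-zero ℓ x
    ... | inj₁ endpoint = ∈-η⁺ ξ A ℓ (x , x∈p∩q⁺ (endpoint⇒∈S endpoint , x∈A)) (endpoint⇒∈S endpoint)
    ... | inj₂ ξℓx≡0    = ⊥-elim (ξℓx≢0 ξℓx≡0)

  module Components (root : Fin N → Fin N)
    (root-merges : ∀ ℓ → root (src ℓ) ≡ root (dst ℓ))
    (closed-respects-root : ∀ {A} → Closed A → ∀ {x y} → x ∈ₛ A → root y ≡ root x → y ∈ₛ A)
    (root-idempotent : ∀ x → root (root x) ≡ root x) where

    component : Fin N → Subset N
    component x = Vec.tabulate (λ y → does (root y ≟ root x))

    ∈-component⁺ : ∀ {x y} → root y ≡ root x → y ∈ₛ component x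
    ∈-component⁺ {x} {y} ry≡rx = ∈-tabulate⁺ (dec-true (root y ≟ root x) ry≡rx)

    ∈-component⁻ : ∀ {x y} → y ∈ₛ component x → root y ≡ root x
    ∈-component⁻ {x} {y} y∈ = does⇒ (root y ≟ root x) (∈-tabulate⁻ y∈)

    component-closed : ∀ x → Closed (component x)
    component-closed x ℓ = (λ s∈ → ∈-component⁺ (trans (sym (root-merges ℓ)) (∈-component⁻ s∈)))
                         , (λ d∈ → ∈-component⁺ (trans (root-merges ℓ) (∈-component⁻ d∈)))

    component-minimal : ∀ x → Minimal ξ (component x)
    component-minimal x = (x , ∈-component⁺ refl) , closed⇒In𝒫 (component-closed x) , no-smaller
      where
      no-smaller : ∀ B → Nonempty B → B ⊆ component x → B ≢ component x → η ξ B ≢ B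
      no-smaller B (y , y∈B) B⊆ B≢ ηB≡B = B≢ (⊆-antisym B⊆ λ z∈ →
        closed-respects-root (In𝒫⇒closed ηB≡B) y∈B (trans (∈-component⁻ z∈) (sym (∈-component⁻ (B⊆ y∈B)))))

    minimal⇒component : ∀ {A} → Minimal ξ A → ∃ λ x → A ≡ component x
    minimal⇒component {A} ((x , x∈A) , ηA≡A , minimal) with ≡-dec Boolₚ._≟_ (component x) A
    ... | yes cx≡A = x , sym cx≡A
    ... | no  cx≢A = ⊥-elim (minimal (component x) (x , ∈-component⁺ refl) cx⊆A cx≢A
                                     (closed⇒In𝒫 (component-closed x)))
      where
      cx⊆A : component x ⊆ A
      cx⊆A y∈ = closed-respects-root (In𝒫⇒closed ηA≡A) x∈A (∈-component⁻ y∈)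

    component-root : ∀ x → component (root x) ≡ component x
    component-root x = cong (λ r → Vec.tabulate (λ y → does (root y ≟ r))) (root-idempotent x)

    roots : List (Fin N)
    roots = filter (λ x → root x ≟ x) (allFin N)

    root-of-root : ∀ {x} → x ∈ roots → root x ≡ x
    root-of-root = proj₂ ∘ ∈-filter⁻ (λ x → root x ≟ x) {xs = allFin N}

    component-injectiveOn-roots : ∀ {x y} → x ∈ roots → y ∈ roots → component x ≡ component y → x ≡ y
    component-injectiveOn-roots {x} x∈ y∈ cx≡cy = begin
      x      ≡⟨ root-of-root x∈ ⟨
      root x ≡⟨ ∈-component⁻ (subst (x ∈ₛ_) cx≡cy (∈-component⁺ refl)) ⟩
      root _ ≡⟨ root-of-root y∈ ⟩
      _      ∎
      where open ≡-Reasoning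

    minimal⇔∈components : ∀ {A} → Minimal ξ A ⇔ A ∈ map component roots
    minimal⇔∈components = mk⇔ to from
      where
      to : ∀ {A} → Minimal ξ A → A ∈ map component roots
      to minA with minimal⇒component minA
      ... | x , refl = subst (_∈ map component roots) (component-root x)
        (∈-map⁺ component (∈-filter⁺ (λ x → root x ≟ x) (∈-allFin (root x)) (root-idempotent x)))
      from : ∀ {A} → A ∈ map component roots → Minimal ξ A
      from A∈ with ∈-map⁻ component A∈
      ... | x , _ , refl = component-minimal x

    #minimal≡#fixedPoints : ∀ {As} → Unique As → (∀ A → (A ∈ As) ⇔ Minimal ξ A) →
                      length As ≡ count (λ x → does (root x ≟ x))
    #minimal≡#fixedPoints {As} As! As⇔minimal = begin
      length As                    ≡⟨ length-unique-⇔ As! components! (⇔-trans (As⇔minimal _) minimal⇔∈components) ⟩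
      length (map component roots) ≡⟨ length-map component roots ⟩
      length roots                 ≡⟨ length-filter-tabulate (λ x → root x ≟ x) id ⟩
      count (λ x → does (root x ≟ x)) ∎
      where
      open ≡-Reasoning
      components! : Unique (map component roots)
      components! = unique-map-injectiveOn component (Uniqueₚ.filter⁺ _ (Uniqueₚ.allFin⁺ N))
                                           component-injectiveOn-roots

  module _ {σ : Fin L → Fin L} where
    open UnionFind (src ∘ σ) (dst ∘ σ)

    #minimal≡#roots : (∀ ℓ → ∃ λ j → σ j ≡ ℓ) → ∀ {As} → Unique As → (∀ A → (A ∈ As) ⇔ Minimal ξ A) →
                      length As ≡ #roots (allFin L)
    #minimal≡#roots σ-surjective =
      Components.#minimal≡#fixedPoints root root-merges closed-respects-root (label-idempotent (allFin L))
      where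
      root : Fin N → Fin N
      root = label (allFin L)
      root-merges : ∀ ℓ → root (src ℓ) ≡ root (dst ℓ)
      root-merges ℓ with σ-surjective ℓ
      ... | j , refl = label-merges (allFin L) (∈-allFin j)
      closed-respects-root : ∀ {A} → Closed A → ∀ {x y} → x ∈ₛ A → root y ≡ root x → y ∈ₛ A
      closed-respects-root closed = label-respects-closed (closed ∘ σ) (allFin L)

    independent⇒acyclic : LinIndep (cols (Ξmat ξ) σ) → Acyclic
    independent⇒acyclic = Span.independent⇒acyclic (λ x i → toℚ (e x i)) (cols (Ξmat ξ) σ)
      (λ j i → trans (cong toℚ (ξ≡e-e (σ j) i)) (toℚ-e-sub (src (σ j)) (dst (σ j)) i))

lemma3p8 : (L N : ℕ) → 1 ≤ L → L < N → N ≤ 2 * L →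
    (ξ : Fin L → Fin N → ℤ) → (∀ ℓ → InF (ξ ℓ)) →
    (∀ n → ∃[ ℓ ] (Ymat ξ ℓ n ≢ 0ℤ)) →
    (As : List (Subset N)) → Unique As → (∀ A → (A ∈ As) ⇔ Minimal ξ A) →
    (N ∸ L ≤ length As) ×
    (HasRank (Ξmat ξ) L → HasRank (Ymat ξ) L → N ∸ L ≡ length As)
lemma3p8 L N _ _ _ ξ ξ∈F covered As As! As⇔minimal = N∸L≤#minimal , N∸L≡#minimal
  where
  open Edges ξ∈F covered

  N∸L≤#minimal : N ∸ L ≤ length As
  N∸L≤#minimal = begin
    N ∸ L              ≤⟨ ℕₚ.m≤n+o⇒m∸n≤o N L N≤E+#roots ⟩
    #roots (allFin L)  ≡⟨ #minimal≡#roots (λ ℓ → ℓ , refl) As! As⇔minimal ⟨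
    length As          ∎
    where
    open ℕₚ.≤-Reasoning
    open UnionFind src dst

  N∸L≡#minimal : HasRank (Ξmat ξ) L → HasRank (Ymat ξ) L → N ∸ L ≡ length As
  N∸L≡#minimal ((σ , σ-injective , independent) , _) _ = begin
    N ∸ L                      ≡⟨ cong (_∸ L) (acyclic⇒E+#roots≡N (independent⇒acyclic independent)) ⟨
    L + #roots (allFin L) ∸ L  ≡⟨ ℕₚ.m+n∸m≡n L _ ⟩
    #roots (allFin L)          ≡⟨ #minimal≡#roots (injective⇒surjective σ-injective) As! As⇔minimal ⟨
    length As                  ∎
    where
    open ≡-Reasoning
    open UnionFind (src ∘ σ) (dst ∘ σ)
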